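{- Let $k$ be a positive integer, let $G$ be any graph without isolated vertices, and let $H$ be a graph with $\gamma(H)=1$. Then \[\gamma_{rk}(G\circ H)\le k\,\gamma(G).\]
   Context: All graphs are finite and simple. For a positive integer $k$, a $k$-rainbow dominating function of a graph $X$ is a map $f\colon V(X)\to 2^{\{1,\dots,k\}}$ such that for every vertex $v$ with $f(v)=\emptyset$ we have $\bigcup_{u\in N(v)} f(u)=\{1,\dots,k\}$, where $N(v)$ is the open neighborhood of $v$. Its weight is $\|f\|=\sum_{v}|f(v)|$, and $\gamma_{rk}(X)$ is the minimum weight of a $k$-rainbow dominating function of $X$. The lexicographic product $G\circ H$ has vertex set $V(G)\times V(H)$, with $(g_1,h_1)$ adjacent to $(g_2,h_2)$ iff $g_1g_2\in E(G)$, or $g_1=g_2$ and $h_1h_2\in E(H)$. $\gamma(X)$ denotes the domination number of $X$ (minimum size of a set $D$ with $N[D]=V(X)$). -}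

module Defs where

open import Data.Nat using (ℕ; _≤_; _+_; _*_)
open import Data.Fin using (Fin; remQuot)
import Data.Fin as F
open import Data.Fin.Subset using (Subset; _∈_; ∣_∣; Empty)
open import Data.Product using (Σ; ∃; _×_; _,_; proj₁; proj₂)
open import Data.Sum using (_⊎_; inj₁; inj₂)
open import Data.Empty using (⊥)
open import Relation.Nullary using (¬_)
open import Relation.Binary.PropositionalEquality using (_≡_; refl)
import Relation.Binary.PropositionalEquality as Eq
open import Level using (0ℓ)

record Graph : Set₁ where
  field
    n    : ℕ
    Adj  : Fin n → Fin n → Set
    sym  : ∀ {u v} → Adj u v → Adj v u
    irr  : ∀ {u} → ¬ Adj u u
open Graph public

sumFin : (m : ℕ) → (Fin m → ℕ) → ℕ
sumFin ℕ.zero f = 0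
sumFin (ℕ.suc m) f = f F.zero + sumFin m (λ i → f (F.suc i))

NoIsolated : Graph → Set
NoIsolated G = ∀ (v : Fin (n G)) → ∃ λ u → Adj G v u

Dominating : (G : Graph) → Subset (n G) → Set
Dominating G D = ∀ (v : Fin (n G)) → v ∈ D ⊎ (∃ λ u → u ∈ D × Adj G v u)

DominationNumber : Graph → ℕ → Set
DominationNumber G d =
  (Σ (Subset (n G)) λ D → Dominating G D × ∣ D ∣ ≡ d)
  × (∀ D → Dominating G D → d ≤ ∣ D ∣)

-- Lexicographic product G ∘ H.  Its vertex set Fin (n G * n H) is identified
-- with Fin (n G) × Fin (n H) via the stdlib bijection remQuot (inverse combine).
LexAdj : (G H : Graph) → Fin (n G) × Fin (n H) → Fin (n G) × Fin (n H) → Set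
LexAdj G H (g₁ , h₁) (g₂ , h₂) = Adj G g₁ g₂ ⊎ (g₁ ≡ g₂ × Adj H h₁ h₂)

lexSym : (G H : Graph) → ∀ {x y} → LexAdj G H x y → LexAdj G H y x
lexSym G H (inj₁ a) = inj₁ (sym G a)
lexSym G H (inj₂ (e , a)) = inj₂ (Eq.sym e , sym H a)

lexIrr : (G H : Graph) → ∀ {x} → ¬ LexAdj G H x x
lexIrr G H (inj₁ a) = irr G a
lexIrr G H (inj₂ (_ , a)) = irr H a

_∘ₗ_ : Graph → Graph → Graph
G ∘ₗ H = record
  { n   = n G * n H
  ; Adj = λ u v → LexAdj G H (remQuot (n H) u) (remQuot (n H) v)
  ; sym = lexSym G H
  ; irr = lexIrr G H
  }

RainbowDominating : (k : ℕ) (X : Graph) → (Fin (n X) → Subset k) → Set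
RainbowDominating k X f =
  ∀ (v : Fin (n X)) → Empty (f v) →
    ∀ (c : Fin k) → ∃ λ u → Adj X v u × c ∈ f u

weight : (k : ℕ) (X : Graph) → (Fin (n X) → Subset k) → ℕ
weight k X f = sumFin (n X) (λ v → ∣ f v ∣)

RainbowDominationNumber : (k : ℕ) → Graph → ℕ → Set
RainbowDominationNumber k X r =
  (Σ (Fin (n X) → Subset k) λ f → RainbowDominating k X f × weight k X f ≡ r)
  × (∀ f → RainbowDominating k X f → r ≤ weight k X f)

-- Let A be a minimum dominating set of G and B = {b} a dominating set of H.
-- Then A × B dominates G ∘ H: a vertex (g , h) with g ∉ A sees (u , b) for a
-- neighbour u ∈ A of g, and one with g ∈ A sees (g , b) inside its own copy
-- of H.  Giving every vertex of a dominating set all k colours, and every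
-- other vertex none, is a k-rainbow dominating function, so
-- γ_rk(G ∘ H) ≤ k |A × B| = k γ(G).
module Submission where

open import Defs hiding (sym)
open import Data.Nat using (ℕ; suc; _≤_; _<_; _+_; _*_; s≤s; z≤n)
open import Data.Nat.Properties using (*-suc; *-zeroʳ; *-identityʳ; ≤-reflexive; ≤-trans)
open import Data.Bool using (true; _∧_; if_then_else_)
open import Data.Fin using (Fin; zero; suc; combine; remQuot)
open import Data.Fin.Properties using (remQuot-combine; combine-remQuot)
open import Data.Fin.Subset using (Subset; _∈_; ∣_∣; Nonempty; ⊤; ⊥; inside; outside)
open import Data.Fin.Subset.Properties using (∈⊤; ∣⊥∣≡0; ∣⊤∣≡n)
open import Data.Vec using ([]; _∷_; _++_; map; lookup; _⊛*_; here; there)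
open import Data.Vec.Properties using (lookup-⊛*; lookup-map; map-id; map-const; []=⇒lookup; lookup⇒[]=)
open import Data.Product using (∃; _,_; _×_; uncurry)
open import Data.Sum using (_⊎_; inj₁; inj₂)
open import Data.Empty using (⊥-elim)
open import Function using (id; const)
open import Relation.Binary.PropositionalEquality

∣p++q∣≡∣p∣+∣q∣ : ∀ {m n} (p : Subset m) (q : Subset n) → ∣ p ++ q ∣ ≡ ∣ p ∣ + ∣ q ∣
∣p++q∣≡∣p∣+∣q∣ []            q = refl
∣p++q∣≡∣p∣+∣q∣ (inside  ∷ p) q = cong suc (∣p++q∣≡∣p∣+∣q∣ p q)
∣p++q∣≡∣p∣+∣q∣ (outside ∷ p) q = ∣p++q∣≡∣p∣+∣q∣ p q

0<∣p∣⇒Nonempty : ∀ {m} (p : Subset m) → 0 < ∣ p ∣ → Nonempty p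
0<∣p∣⇒Nonempty (inside  ∷ p) _     = zero , here
0<∣p∣⇒Nonempty (outside ∷ p) 0<∣p∣ with 0<∣p∣⇒Nonempty p 0<∣p∣
... | x , x∈p = suc x , there x∈p

-- Cartesian product of subsets, indexed like the vertices of G ∘ₗ H.
_⊗_ : ∀ {m n} → Subset m → Subset n → Subset (m * n)
A ⊗ B = map _∧_ A ⊛* B

∣A⊗B∣≡∣A∣*∣B∣ : ∀ {m n} (A : Subset m) (B : Subset n) → ∣ A ⊗ B ∣ ≡ ∣ A ∣ * ∣ B ∣
∣A⊗B∣≡∣A∣*∣B∣ []            B = refl
∣A⊗B∣≡∣A∣*∣B∣ (inside  ∷ A) B = begin
  ∣ map id B ++ A ⊗ B ∣      ≡⟨ ∣p++q∣≡∣p∣+∣q∣ (map id B) (A ⊗ B) ⟩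
  ∣ map id B ∣ + ∣ A ⊗ B ∣   ≡⟨ cong₂ _+_ (cong ∣_∣ (map-id B)) (∣A⊗B∣≡∣A∣*∣B∣ A B) ⟩
  ∣ B ∣ + ∣ A ∣ * ∣ B ∣      ∎
  where open ≡-Reasoning
∣A⊗B∣≡∣A∣*∣B∣ {n = n} (outside ∷ A) B = begin
  ∣ map (const outside) B ++ A ⊗ B ∣     ≡⟨ ∣p++q∣≡∣p∣+∣q∣ (map (const outside) B) (A ⊗ B) ⟩
  ∣ map (const outside) B ∣ + ∣ A ⊗ B ∣  ≡⟨ cong₂ _+_ (trans (cong ∣_∣ (map-const B outside)) (∣⊥∣≡0 n))
                                                      (∣A⊗B∣≡∣A∣*∣B∣ A B) ⟩
  ∣ A ∣ * ∣ B ∣                          ∎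
  where open ≡-Reasoning

combine-∈-⊗ : ∀ {m n} {A : Subset m} {B : Subset n} {g h} →
  g ∈ A → h ∈ B → combine g h ∈ A ⊗ B
combine-∈-⊗ {A = A} {B} {g} {h} g∈A h∈B = lookup⇒[]= (combine g h) (A ⊗ B) (begin
  lookup (A ⊗ B) (combine g h)           ≡⟨ lookup-⊛* (map _∧_ A) B g h ⟩
  lookup (map _∧_ A) g (lookup B h)      ≡⟨ cong (λ f → f (lookup B h)) (lookup-map g _∧_ A) ⟩
  lookup A g ∧ lookup B h                ≡⟨ cong₂ _∧_ ([]=⇒lookup g∈A) ([]=⇒lookup h∈B) ⟩
  true                                   ∎)
  where open ≡-Reasoning

⊗-dominating : ∀ G H {A B} → Dominating G A → Dominating H B → Nonempty B →
  Dominating (G ∘ₗ H) (A ⊗ B)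
⊗-dominating G H {A} {B} domA domB (b , b∈B) v =
  subst Dominated (combine-remQuot {n G} (n H) v) (combine-dominated (remQuot (n H) v))
  where
  Dominated : Fin (n G * n H) → Set
  Dominated v = v ∈ A ⊗ B ⊎ ∃ λ u → u ∈ A ⊗ B × Adj (G ∘ₗ H) v u

  lexAdj⇒adj : ∀ {g h g′ h′} → LexAdj G H (g , h) (g′ , h′) →
    Adj (G ∘ₗ H) (combine g h) (combine g′ h′)
  lexAdj⇒adj {g} {h} {g′} {h′} =
    subst₂ (LexAdj G H) (sym (remQuot-combine g h)) (sym (remQuot-combine g′ h′))

  combine-dominated : ∀ p → Dominated (uncurry combine p)
  combine-dominated (g , h) with domA g
  ... | inj₂ (u , u∈A , g~u) = inj₂ (combine u b , combine-∈-⊗ u∈A b∈B , lexAdj⇒adj (inj₁ g~u))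
  ... | inj₁ g∈A with domB h
  ...   | inj₁ h∈B = inj₁ (combine-∈-⊗ g∈A h∈B)
  ...   | inj₂ (h′ , h′∈B , h~h′) =
          inj₂ (combine g h′ , combine-∈-⊗ g∈A h′∈B , lexAdj⇒adj (inj₂ (refl , h~h′)))

fullOn : ∀ k {m} → Subset m → Fin m → Subset k
fullOn k D v = if lookup D v then ⊤ else ⊥

∈-fullOn : ∀ {k m} {D : Subset m} {v} (c : Fin k) → v ∈ D → c ∈ fullOn k D v
∈-fullOn c v∈D rewrite []=⇒lookup v∈D = ∈⊤

fullOn-rainbowDominating : ∀ k X {D} → Dominating X D → RainbowDominating k X (fullOn k D)
fullOn-rainbowDominating k X domD v fv-empty c with domD v
... | inj₁ v∈D = ⊥-elim (fv-empty (c , ∈-fullOn c v∈D))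
... | inj₂ (u , u∈D , v~u) = u , v~u , ∈-fullOn c u∈D

sumFin-∣fullOn∣ : ∀ k {m} (D : Subset m) → sumFin m (λ v → ∣ fullOn k D v ∣) ≡ k * ∣ D ∣
sumFin-∣fullOn∣ k []            = sym (*-zeroʳ k)
sumFin-∣fullOn∣ k (inside  ∷ D) = begin
  ∣ ⊤ {k} ∣ + sumFin _ (λ v → ∣ fullOn k D v ∣) ≡⟨ cong₂ _+_ (∣⊤∣≡n k) (sumFin-∣fullOn∣ k D) ⟩
  k + k * ∣ D ∣                                ≡⟨ sym (*-suc k ∣ D ∣) ⟩
  k * suc ∣ D ∣                                ∎
  where open ≡-Reasoning
sumFin-∣fullOn∣ k (outside ∷ D) = cong₂ _+_ (∣⊥∣≡0 k) (sumFin-∣fullOn∣ k D)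

rainbowDomination≤k*dominating : ∀ k X {r D} → RainbowDominationNumber k X r →
  Dominating X D → r ≤ k * ∣ D ∣
rainbowDomination≤k*dominating k X {D = D} (_ , minimal) domD =
  ≤-trans (minimal (fullOn k D) (fullOn-rainbowDominating k X domD))
          (≤-reflexive (sumFin-∣fullOn∣ k D))

proposition4 : (k : ℕ) → 1 ≤ k → (G H : Graph) → NoIsolated G →
    DominationNumber H 1 →
    (d r : ℕ) → DominationNumber G d →
    RainbowDominationNumber k (G ∘ₗ H) r → r ≤ k * d
proposition4 k _ G H _ ((B , domB , ∣B∣≡1) , _) d r ((A , domA , ∣A∣≡d) , _) γrk≡r =
  ≤-trans (rainbowDomination≤k*dominating k (G ∘ₗ H) γrk≡r (⊗-dominating G H domA domB B≢∅))
          (≤-reflexive k*∣A⊗B∣≡k*d)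
  where
  B≢∅ : Nonempty B
  B≢∅ = 0<∣p∣⇒Nonempty B (subst (0 <_) (sym ∣B∣≡1) (s≤s z≤n))

  k*∣A⊗B∣≡k*d : k * ∣ A ⊗ B ∣ ≡ k * d
  k*∣A⊗B∣≡k*d = cong (k *_) (begin
    ∣ A ⊗ B ∣      ≡⟨ ∣A⊗B∣≡∣A∣*∣B∣ A B ⟩
    ∣ A ∣ * ∣ B ∣  ≡⟨ cong₂ _*_ ∣A∣≡d ∣B∣≡1 ⟩
    d * 1          ≡⟨ *-identityʳ d ⟩
    d              ∎)
    where open ≡-Reasoning
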